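{- Let $G$ be a finite bipartite graph with bipartition $(X, Y)$, and suppose $Y$ contains no isolated vertices. Then there is a partial total coloring of $G$ with the two colors red and blue that is TLIR and such that: (i) every vertex of $X$ is colored red or blue; (ii) every vertex of $X$ has even total red-degree; (iii) every vertex of $Y$ is uncolored; (iv) every vertex of $Y$ has odd red-degree; (v) the uncolored edges form a matching.
   Context: A partial total coloring assigns colors to some (possibly not all) vertices and edges of $G$. For a color $c$ and a vertex $w$, the total $c$-degree of $w$ is the number of edges of color $c$ incident to $w$, plus $1$ if $w$ is colored $c$ (an uncolored vertex contributes $0$); the $c$-degree of $w$ is the number of edges of color $c$ incident to $w$. A partial total coloring is TLIR (locally irregular) if for every colored edge $uw$, with $c$ its color, the total $c$-degrees of $u$ and $w$ differ. -}

module Defs where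

open import Data.Nat using (ℕ; zero; suc; _+_)
open import Data.Fin using (Fin; zero; suc)
open import Data.Bool using (Bool; true; false; _∧_; if_then_else_)
open import Data.Maybe using (Maybe; just; nothing)
open import Data.Product using (Σ; _×_; ∃)
open import Data.Nat.Divisibility using (_∣_)
open import Relation.Nullary using (¬_)
open import Relation.Binary.PropositionalEquality using (_≡_; _≢_)

data Colour : Set where
  red blue : Colour

colourEq : Colour → Colour → Bool
colourEq red  red  = true
colourEq blue blue = true
colourEq red  blue = false
colourEq blue red  = false

hasColour : Maybe Colour → Colour → Bool
hasColour nothing  c = false
hasColour (just d) c = colourEq d c

count : ∀ {n} → (Fin n → Bool) → ℕ
count {zero}  p = 0
count {suc n} p = (if p zero then 1 else 0) + count (λ i → p (suc i))

-- A finite simple bipartite graph with bipartition (X , Y), X = Fin m, Y = Fin n: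
-- adj x y = true iff xy is an edge.
record BipGraph (m n : ℕ) : Set where
  field
    adj : Fin m → Fin n → Bool
open BipGraph public

-- A partial total colouring: vertices of X, vertices of Y and edges get Maybe Colour
-- (nothing = uncoloured).  The value of edgeCol on non-edges is irrelevant.
record PartialTotalColouring (m n : ℕ) : Set where
  field
    colX    : Fin m → Maybe Colour
    colY    : Fin n → Maybe Colour
    edgeCol : Fin m → Fin n → Maybe Colour
open PartialTotalColouring public

module _ {m n : ℕ} (G : BipGraph m n) (φ : PartialTotalColouring m n) where

  degX : Colour → Fin m → ℕ
  degX c x = count (λ y → adj G x y ∧ hasColour (edgeCol φ x y) c)

  degY : Colour → Fin n → ℕ
  degY c y = count (λ x → adj G x y ∧ hasColour (edgeCol φ x y) c)

  totDegX : Colour → Fin m → ℕ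
  totDegX c x = degX c x + (if hasColour (colX φ x) c then 1 else 0)

  totDegY : Colour → Fin n → ℕ
  totDegY c y = degY c y + (if hasColour (colY φ y) c then 1 else 0)

  TLIR : Set
  TLIR = ∀ x y c → adj G x y ≡ true → edgeCol φ x y ≡ just c →
         totDegX c x ≢ totDegY c y

  UncolouredMatching : Set
  UncolouredMatching =
    (∀ x y y' → adj G x y ≡ true → adj G x y' ≡ true →
       edgeCol φ x y ≡ nothing → edgeCol φ x y' ≡ nothing → y ≡ y')
    × (∀ x x' y → adj G x y ≡ true → adj G x' y ≡ true →
       edgeCol φ x y ≡ nothing → edgeCol φ x' y ≡ nothing → x ≡ x')

NoIsolatedY : ∀ {m n} → BipGraph m n → Set
NoIsolatedY {m} {n} G = ∀ (y : Fin n) → ∃ λ (x : Fin m) → adj G x y ≡ true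

-- Fix for every y ∈ Y an anchor neighbour a(y), and call the edge a(y)y reserved when deg y is even.
-- Unreserved edges are red, so every y has odd red degree: deg y, or deg y − 1 when deg y is
-- even.  A vertex x ∈ X is coloured so as to make its total red degree even, hence red edges
-- are irregular by parity.  A reserved edge is blue when its end x meets at least two reserved
-- edges and uncoloured otherwise: a blue edge then joins blue degree ≥ 2 in X to blue degree
-- ≤ 1 in Y (y meets only one reserved edge), and the uncoloured edges form a matching.
module Submission where

open import Defs
open import Data.Nat using (ℕ; zero; suc; _+_; _≤_; _<_; _≤ᵇ_; z≤n; s≤s)
open import Data.Nat.Properties using (≤-trans; ≤-reflexive; m≤n⇒m≤1+n; m≤m+n; +-suc; +-comm; +-identityʳ; <⇒≱; ≰⇒>; ≤ᵇ-reflects-≤)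
open import Data.Nat.Divisibility using (_∣_; _∤_; _∣?_; _∣0; ∣-refl; ∣m∣n⇒∣m+n; ∣m+n∣m⇒∣n; >⇒∤)
open import Data.Fin using (Fin; zero; suc)
open import Data.Fin.Properties using (_≟_)
open import Data.Bool using (Bool; true; false; _∧_; not; if_then_else_)
open import Data.Bool.Properties using (∧-identityʳ)
open import Data.Maybe using (Maybe; just; nothing)
open import Data.Product using (Σ; _×_; ∃; _,_; proj₁; proj₂)
open import Data.Sum using (_⊎_; inj₁; inj₂)
open import Function using (_∘_)
open import Relation.Nullary using (¬_; yes; no; does; contradiction; proof; ofʸ; ofⁿ)
open import Relation.Nullary.Decidable using (dec-true; dec-false)
open import Relation.Binary.PropositionalEquality using (_≡_; refl; sym; trans; cong; cong₂; subst; module ≡-Reasoning)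

∧-trueʳ : ∀ a {b} → a ∧ b ≡ true → b ≡ true
∧-trueʳ true ab = ab

count-cong : ∀ {n} {p q : Fin n → Bool} → (∀ i → p i ≡ q i) → count p ≡ count q
count-cong {zero}          p≗q = refl
count-cong {suc n} {p} {q} p≗q rewrite p≗q zero = cong (_ +_) (count-cong (p≗q ∘ suc))

count-mono : ∀ {n} {p q : Fin n → Bool} → (∀ i → p i ≡ true → q i ≡ true) → count p ≤ count q
count-mono {zero}          p⇒q = z≤n
count-mono {suc n} {p} {q} p⇒q with p zero in p₀ | q zero in q₀
... | false | false = count-mono (p⇒q ∘ suc)
... | false | true  = m≤n⇒m≤1+n (count-mono (p⇒q ∘ suc))
... | true  | true  = s≤s (count-mono (p⇒q ∘ suc))
... | true  | false = contradiction (trans (sym (p⇒q zero p₀)) q₀) λ ()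

count-false : ∀ n → count {n} (λ _ → false) ≡ 0
count-false zero    = refl
count-false (suc n) = count-false n

count-≟ : ∀ {n} (a : Fin n) → count (λ i → does (i ≟ a)) ≡ 1
count-≟ {suc n} zero    = cong suc (count-false n)
count-≟         (suc a) = count-≟ a

count-remove : ∀ {n} (p : Fin n → Bool) {a : Fin n} → p a ≡ true →
               count p ≡ suc (count (λ i → p i ∧ not (does (i ≟ a))))
count-remove p {zero} pa rewrite pa =
  cong suc (count-cong (λ i → sym (∧-identityʳ (p (suc i)))))
count-remove p {suc a} pa = begin
  ind (p zero) + count (p ∘ suc)      ≡⟨ cong (ind (p zero) +_) (count-remove (p ∘ suc) pa) ⟩
  ind (p zero) + suc rest             ≡⟨ +-suc (ind (p zero)) rest ⟩
  suc (ind (p zero) + rest)           ≡⟨ cong (λ b → suc (ind b + rest)) (sym (∧-identityʳ (p zero))) ⟩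
  suc (ind (p zero ∧ true) + rest)    ∎
  where
  open ≡-Reasoning
  ind : Bool → ℕ
  ind b = if b then 1 else 0
  rest : ℕ
  rest = count (λ i → p (suc i) ∧ not (does (i ≟ a)))

count-pos : ∀ {n} (p : Fin n → Bool) {a : Fin n} → p a ≡ true → 0 < count p
count-pos p pa rewrite count-remove p pa = s≤s z≤n

count≤1 : ∀ {n} {p : Fin n → Bool} (a : Fin n) → (∀ i → p i ≡ true → i ≡ a) → count p ≤ 1
count≤1 a p⇒a = ≤-trans (count-mono (λ i → dec-true (i ≟ a) ∘ p⇒a i)) (≤-reflexive (count-≟ a))

count<2⇒unique : ∀ {n} (p : Fin n → Bool) {a b : Fin n} → count p < 2 →
                 p a ≡ true → p b ≡ true → a ≡ b
count<2⇒unique p {a} {b} count<2 pa pb with a ≟ b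
... | yes a≡b = a≡b
... | no  a≢b = contradiction 2≤count (<⇒≱ count<2)
  where
  p∖a : Fin _ → Bool
  p∖a i = p i ∧ not (does (i ≟ a))
  p∖a-b : p∖a b ≡ true
  p∖a-b rewrite pb | dec-false (b ≟ a) (a≢b ∘ sym) = refl
  2≤count : 2 ≤ count p
  2≤count = ≤-trans (s≤s (count-pos p∖a p∖a-b)) (≤-reflexive (sym (count-remove p pa)))

2∤⇒2∣suc : ∀ k → 2 ∤ k → 2 ∣ suc k
2∤⇒2∣suc zero          2∤0   = contradiction (2 ∣0) 2∤0
2∤⇒2∣suc (suc zero)    _     = ∣-refl
2∤⇒2∣suc (suc (suc k)) 2∤2+k = ∣m∣n⇒∣m+n ∣-refl (2∤⇒2∣suc k (2∤2+k ∘ ∣m∣n⇒∣m+n ∣-refl))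

2∣suc⇒2∤ : ∀ k → 2 ∣ suc k → 2 ∤ k
2∣suc⇒2∤ zero          2∣1   _   = >⇒∤ (s≤s (s≤s z≤n)) 2∣1
2∣suc⇒2∤ (suc zero)    _     2∣1 = >⇒∤ (s≤s (s≤s z≤n)) 2∣1
2∣suc⇒2∤ (suc (suc k)) 2∣3+k 2∣2+k =
  2∣suc⇒2∤ k (∣m+n∣m⇒∣n 2∣3+k ∣-refl) (∣m+n∣m⇒∣n 2∣2+k ∣-refl)

parityColour : ℕ → Colour
parityColour k = if does (2 ∣? k) then blue else red

parityColour-evens : ∀ k → 2 ∣ k + (if hasColour (just (parityColour k)) red then 1 else 0)
parityColour-evens k with does (2 ∣? k) | proof (2 ∣? k)
... | true  | ofʸ 2∣k = subst (2 ∣_) (sym (+-identityʳ k)) 2∣k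
... | false | ofⁿ 2∤k = subst (2 ∣_) (+-comm 1 k) (2∤⇒2∣suc k 2∤k)

module Construction {m n : ℕ} (G : BipGraph m n) (anchor : Fin n → Fin m)
                    (anchor-adj : ∀ y → adj G (anchor y) y ≡ true) where

  degree : Fin n → ℕ
  degree y = count (λ x → adj G x y)

  reserved : Fin m → Fin n → Bool
  reserved x y = does (2 ∣? degree y) ∧ does (x ≟ anchor y)

  reservedDegree : Fin m → ℕ
  reservedDegree x = count (reserved x)

  edgeColour : Fin m → Fin n → Maybe Colour
  edgeColour x y =
    if reserved x y then (if 2 ≤ᵇ reservedDegree x then just blue else nothing) else just red

  redDegree : Fin m → ℕ
  redDegree x = count (λ y → adj G x y ∧ not (reserved x y))

  φ : PartialTotalColouring m n
  φ = record { colX    = λ x → just (parityColour (redDegree x))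
             ; colY    = λ _ → nothing
             ; edgeCol = edgeColour }

  reserved⇒anchor : ∀ x y → reserved x y ≡ true → x ≡ anchor y
  reserved⇒anchor x y r with x ≟ anchor y | ∧-trueʳ (does (2 ∣? degree y)) r
  ... | yes x≡a | _ = x≡a

  reserved⇒adj : ∀ x y → reserved x y ≡ true → adj G x y ≡ true
  reserved⇒adj x y r = subst (λ x → adj G x y ≡ true) (sym (reserved⇒anchor x y r)) (anchor-adj y)

  red⇔unreserved : ∀ x y → hasColour (edgeColour x y) red ≡ not (reserved x y)
  red⇔unreserved x y with reserved x y | 2 ≤ᵇ reservedDegree x | ≤ᵇ-reflects-≤ 2 (reservedDegree x)
  ... | false | _     | _ = refl
  ... | true  | true  | _ = refl
  ... | true  | false | _ = refl

  blue⇒reserved : ∀ x y → hasColour (edgeColour x y) blue ≡ true → reserved x y ≡ true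
  blue⇒reserved x y b with reserved x y | 2 ≤ᵇ reservedDegree x | ≤ᵇ-reflects-≤ 2 (reservedDegree x)
  ... | true | _ | _ = refl

  reserved⇒blue : ∀ x y → 2 ≤ reservedDegree x → reserved x y ≡ true →
                  hasColour (edgeColour x y) blue ≡ true
  reserved⇒blue x y 2≤d r with reserved x y | 2 ≤ᵇ reservedDegree x | ≤ᵇ-reflects-≤ 2 (reservedDegree x)
  ... | true | true  | _        = refl
  ... | true | false | ofⁿ 2≰d = contradiction 2≤d 2≰d

  uncoloured⇒ : ∀ x y → edgeColour x y ≡ nothing →
                reserved x y ≡ true × reservedDegree x < 2
  uncoloured⇒ x y u with reserved x y | 2 ≤ᵇ reservedDegree x | ≤ᵇ-reflects-≤ 2 (reservedDegree x)
  ... | true | false | ofⁿ 2≰d = refl , ≰⇒> 2≰d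

  coloured⇒ : ∀ x y {c} → edgeColour x y ≡ just c →
              c ≡ red ⊎ (c ≡ blue × 2 ≤ reservedDegree x)
  coloured⇒ x y e with reserved x y | 2 ≤ᵇ reservedDegree x | ≤ᵇ-reflects-≤ 2 (reservedDegree x)
  coloured⇒ x y refl | false | _    | _       = inj₁ refl
  coloured⇒ x y refl | true  | true | ofʸ 2≤d = inj₂ (refl , 2≤d)

  redDegreeX : ∀ x → degX G φ red x ≡ redDegree x
  redDegreeX x = count-cong (λ y → cong (adj G x y ∧_) (red⇔unreserved x y))

  evenTotalRedX : ∀ x → 2 ∣ totDegX G φ red x
  evenTotalRedX x rewrite redDegreeX x = parityColour-evens (redDegree x)

  oddRedY : ∀ y → 2 ∤ degY G φ red y
  oddRedY y rewrite count-cong (λ x → cong (adj G x y ∧_) (red⇔unreserved x y))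
    with does (2 ∣? degree y) | proof (2 ∣? degree y)
  ... | false | ofⁿ 2∤deg = subst (2 ∤_) (count-cong (λ x → sym (∧-identityʳ (adj G x y)))) 2∤deg
  ... | true  | ofʸ 2∣deg =
    2∣suc⇒2∤ _ (subst (2 ∣_) (count-remove (λ x → adj G x y) (anchor-adj y)) 2∣deg)

  blueDegreeY≤1 : ∀ y → degY G φ blue y ≤ 1
  blueDegreeY≤1 y = count≤1 (anchor y) (λ x → reserved⇒anchor x y ∘ blue⇒reserved x y ∘ ∧-trueʳ (adj G x y))

  blueDegreeX≥2 : ∀ x → 2 ≤ reservedDegree x → 2 ≤ degX G φ blue x
  blueDegreeX≥2 x 2≤d = ≤-trans 2≤d (count-mono reserved⇒adj∧blue)
    where
    reserved⇒adj∧blue : ∀ y → reserved x y ≡ true → adj G x y ∧ hasColour (edgeColour x y) blue ≡ true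
    reserved⇒adj∧blue y r = cong₂ _∧_ (reserved⇒adj x y r) (reserved⇒blue x y 2≤d r)

  tlir : TLIR G φ
  tlir x y c _ e with coloured⇒ x y e
  ... | inj₁ refl = λ eq →
    oddRedY y (subst (2 ∣_) (trans eq (+-identityʳ _)) (evenTotalRedX x))
  ... | inj₂ (refl , 2≤d) = λ eq →
    <⇒≱ (s≤s (≤-trans (≤-reflexive (+-identityʳ _)) (blueDegreeY≤1 y)))
        (subst (2 ≤_) eq (≤-trans (blueDegreeX≥2 x 2≤d) (m≤m+n _ _)))

  uncolouredMatching : UncolouredMatching G φ
  uncolouredMatching =
      (λ x y y′ _ _ u u′ →
        let (r , d<2) = uncoloured⇒ x y u in
        count<2⇒unique (reserved x) d<2 r (proj₁ (uncoloured⇒ x y′ u′)))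
    , (λ x x′ y _ _ u u′ →
        trans (reserved⇒anchor x y (proj₁ (uncoloured⇒ x y u)))
              (sym (reserved⇒anchor x′ y (proj₁ (uncoloured⇒ x′ y u′)))))

lemma3 : ∀ (m n : ℕ) (G : BipGraph m n) → NoIsolatedY G →
    Σ (PartialTotalColouring m n) λ φ →
    TLIR G φ
    × (∀ x → ∃ λ c → colX φ x ≡ just c)
    × (∀ x → 2 ∣ totDegX G φ red x)
    × (∀ y → colY φ y ≡ nothing)
    × (∀ y → ¬ (2 ∣ degY G φ red y))
    × UncolouredMatching G φ
lemma3 m n G noIsolated =
  φ , tlir , (λ x → _ , refl) , evenTotalRedX , (λ _ → refl) , oddRedY , uncolouredMatching
  where open Construction G (proj₁ ∘ noIsolated) (proj₂ ∘ noIsolated)
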